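{- Let $x\in \Sigma^n$ and let $i,j\in [0\,..\, n]$ with $j-i\ge 2$ and $h(i+1,j-1) = h(i,j)$. Then every $k^*\in (i\,..\, j)$ with $h(k^*)=h(i,j)$ satisfies $\mathrm{GD}(i,j)=\mathrm{GD}(i,k^*)+\mathrm{GD}(k^*,j)$.
   Context: $\Sigma$ is the disjoint union of opening parentheses $T$ and closing parentheses $\overline{T}$ with a bijection $a\mapsto\overline{a}$; $\mathsf{dyck}(y)$ is the minimum number of insertions, deletions and substitutions turning $y$ into a string of the Dyck language (generated by $S\to SS\mid\varnothing\mid aS\overline{a}$, $a\in T$). For $x\in\Sigma^n$: height $h(i)=|\{j\in[1..i]:x[j]\in T\}|-|\{j\in[1..i]:x[j]\in\overline{T}\}|$, $h(i,j)=\min_{k\in[i..j]}h(k)$. A valley is $v\in[1..n)$ with $h(v-1)>h(v)<h(v+1)$; $K\subseteq[0..n]$ consists of the positions at distance $0$ or $1$ from a valley. $\mathrm{GD}(i,i)=0$, $\mathrm{GD}(i,i+1)=1$, and for $j-i\ge2$, $\mathrm{GD}(i,j)$ is the minimum of $\mathrm{GD}(i,k)+\mathrm{GD}(k,j)$ over $k\in(i..j)\cap(K\cup\{i+1,i+2,j-2,j-1\})$ and, only if $h(i+1,j-1)>h(i,j)$, of $\mathrm{GD}(i+1,j-1)+\mathsf{dyck}(x[i+1]x[j])$. $(i..j)$ denotes integers strictly between $i$ and $j$. -}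

module Defs where

open import Data.Nat using (ℕ; zero; suc; _+_; _∸_; _≤_; _<_; _⊓_)
open import Data.Integer as ℤ using (ℤ)
open import Data.List using (List; []; _∷_; _++_; take; length; map; filter; foldr)
open import Data.List.Membership.Propositional using (_∈_)
open import Data.Bool using (Bool; true; false; _∨_; _∧_; if_then_else_)
open import Data.Maybe using (Maybe; just; nothing)
open import Data.Product using (Σ; _×_; _,_; ∃)
open import Relation.Nullary using (does)
open import Relation.Binary.PropositionalEquality using (_≡_)

-- Alphabet Σ = T ⊎ T̄ : opening parentheses  opn a  (a ∈ T) and
-- closing parentheses  cls a  (= ā), so a ↦ ā is the bijection opn a ↦ cls a.

data Sym (T : Set) : Set where
  opn : T → Sym T
  cls : T → Sym T

module _ {T : Set} where

  data IsDyck : List (Sym T) → Set where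
    dyck-ε    : IsDyck []
    dyck-cat  : ∀ {u v} → IsDyck u → IsDyck v → IsDyck (u ++ v)
    dyck-wrap : ∀ (a : T) {u} → IsDyck u → IsDyck (opn a ∷ u ++ cls a ∷ [])

  data Edits : List (Sym T) → List (Sym T) → ℕ → Set where
    e-nil : Edits [] [] 0
    e-del : ∀ {c ys ws d} → Edits ys ws d → Edits (c ∷ ys) ws (suc d)
    e-ins : ∀ {c ys ws d} → Edits ys ws d → Edits ys (c ∷ ws) (suc d)
    e-sub : ∀ {a b ys ws d} → Edits ys ws d → Edits (a ∷ ys) (b ∷ ws) (suc d)
    e-keep : ∀ {c ys ws d} → Edits ys ws d → Edits (c ∷ ys) (c ∷ ws) d

  IsDyckDist : List (Sym T) → ℕ → Set
  IsDyckDist y d =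
    (Σ (List (Sym T)) λ w → IsDyck w × Edits y w d)
    × (∀ w d′ → IsDyck w → Edits y w d′ → d ≤ d′)

  IsDyckFun : (List (Sym T) → ℕ) → Set
  IsDyckFun dyck = ∀ y → IsDyckDist y (dyck y)

  -- Heights.  x ∈ Σⁿ is a list of length n, x[m] (1-based) = nth x (m-1).

  step : Sym T → ℤ
  step (opn _) = ℤ.+ 1
  step (cls _) = ℤ.- (ℤ.+ 1)

  height : List (Sym T) → ℤ
  height []      = ℤ.+ 0
  height (c ∷ s) = step c ℤ.+ height s

  h : List (Sym T) → ℕ → ℤ
  h x i = height (take i x)

  hmin-from : List (Sym T) → ℕ → ℕ → ℤ
  hmin-from x i zero    = h x i
  hmin-from x i (suc d) = hmin-from x i d ℤ.⊓ h x (i + suc d)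

  hr : List (Sym T) → ℕ → ℕ → ℤ
  hr x i j = hmin-from x i (j ∸ i)

  isValley : List (Sym T) → ℕ → Bool
  isValley x zero    = false
  isValley x (suc u) =
    does (suc u Data.Nat.<? length x)
    ∧ does (h x (suc u) ℤ.<? h x u)
    ∧ does (h x (suc u) ℤ.<? h x (suc (suc u)))

  inK : List (Sym T) → ℕ → Bool
  inK x p = does (p Data.Nat.≤? length x)
            ∧ (isValley x p ∨ isValley x (suc p) ∨ prevValley p)
    where
      prevValley : ℕ → Bool
      prevValley zero    = false
      prevValley (suc q) = isValley x q

  nth : List (Sym T) → ℕ → Maybe (Sym T)
  nth []      _       = nothing
  nth (c ∷ s) zero    = just c
  nth (c ∷ s) (suc m) = nth s m

  toL : Maybe (Sym T) → List (Sym T)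
  toL nothing  = []
  toL (just c) = c ∷ []

  between : ℕ → ℕ → List ℕ
  between i j = go (j ∸ suc i) (suc i)
    where
      go : ℕ → ℕ → List ℕ
      go zero    _ = []
      go (suc c) k = k ∷ go c (suc k)

  _==_ : ℕ → ℕ → Bool
  a == b = does (a Data.Nat.≟ b)

  allowed : List (Sym T) → ℕ → ℕ → ℕ → Bool
  allowed x i j k = inK x k ∨ (k == suc i) ∨ (k == suc (suc i))
                    ∨ (k == (j ∸ 2)) ∨ (k == (j ∸ 1))

  min⁺ : ℕ → List ℕ → ℕ
  min⁺ a as = foldr _⊓_ a as

  -- GDf fuel x i j : GD(i,j), computed with recursion fuel
  -- (the value is the intended one whenever fuel > j − i, see GD below).
  GDf : (List (Sym T) → ℕ) → ℕ → List (Sym T) → ℕ → ℕ → ℕ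
  GDf dyck zero       x i j = 0
  GDf dyck (suc fuel) x i j with j ∸ i
  ... | zero        = 0
  ... | suc zero    = 1
  ... | suc (suc _) =
    min⁺ (split (suc i)) (map split (filter (λ k → allowed x i j k Data.Bool.≟ true) (between i j)) ++ nested)
    where
      split : ℕ → ℕ
      split k = GDf dyck fuel x i k + GDf dyck fuel x k j
      nested : List ℕ
      nested = if does (hr x i j ℤ.<? hr x (suc i) (j ∸ 1))
               then (GDf dyck fuel x (suc i) (j ∸ 1)
                     + dyck (toL (nth x i) ++ toL (nth x (j ∸ 1)))) ∷ []
               else []

  GD : (List (Sym T) → ℕ) → List (Sym T) → ℕ → ℕ → ℕ
  GD dyck x i j = GDf dyck (suc (j ∸ i)) x i j

-- Heights move by ±1, so an interior point k where h attains its minimum over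
-- [i..j] is a valley: it is a permitted split point of GD(i,j), and the option
-- matching x[i+1] with x[j] is unavailable because h(i+1,j−1) = h(k) = h(i,j).
-- Hence GD(i,j) ≤ GD(i,k) + GD(k,j). Conversely, every other permitted split
-- point k′ lies on one side of k, say k′ < k. Then k′ is also permitted in
-- [i..k], and k is a lowest point of [k′..j], so by induction on j − i
--   GD(i,k′) + GD(k′,j) = GD(i,k′) + GD(k′,k) + GD(k,j) ≥ GD(i,k) + GD(k,j).
module Submission where

open import Defs
open import Data.Bool as Bool using (true; false; _∨_; _∧_; if_then_else_)
open import Data.Bool.Properties using (T-≡; ∨-zeroʳ)
open import Data.Integer as ℤ using (ℤ)
import Data.Integer.Properties as ℤ
open import Data.List using (List; []; _∷_; _++_; length; map; filter)
open import Data.List.Membership.Propositional using (_∈_; lose)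
open import Data.List.Membership.Propositional.Properties
  using (∈-map⁺; ∈-map⁻; ∈-++⁺ˡ; ∈-++⁻; ∈-filter⁺; ∈-filter⁻)
open import Data.List.Properties using (foldr-preservesᵇ; foldr-preservesᵒ; map-cong-local)
open import Data.List.Relation.Unary.All using (tabulate)
open import Data.List.Relation.Unary.Any using (here; there)
open import Data.Nat
open import Data.Nat.Properties
open import Data.Product using (∃; _×_; _,_)
open import Data.Sum using (_⊎_; inj₁; inj₂; [_,_])
open import Function using (id; Equivalence)
open import Relation.Nullary using (¬_; contradiction; does)
open import Relation.Nullary.Decidable using (yes; no; dec-true; dec-false)
open import Relation.Binary.Definitions using (tri<; tri≈; tri>)
open import Relation.Binary.PropositionalEquality hiding ([_])

upFrom : ℕ → ℕ → List ℕ
upFrom zero    s = []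
upFrom (suc c) s = s ∷ upFrom c (suc s)

upFrom-unique : (G : ℕ → ℕ → List ℕ) → (∀ s → G 0 s ≡ []) →
                (∀ c s → G (suc c) s ≡ s ∷ G c (suc s)) → ∀ c s → G c s ≡ upFrom c s
upFrom-unique G G-zero G-suc zero    s = G-zero s
upFrom-unique G G-zero G-suc (suc c) s =
  trans (G-suc c s) (cong (s ∷_) (upFrom-unique G G-zero G-suc c (suc s)))

∈-upFrom⁻ : ∀ c s {k} → k ∈ upFrom c s → s ≤ k × k < s + c
∈-upFrom⁻ (suc c) s (here refl) = ≤-refl , m<m+n s z<s
∈-upFrom⁻ (suc c) s {k} (there k∈) with ∈-upFrom⁻ c (suc s) k∈
... | s<k , k< = <⇒≤ s<k , subst (k <_) (sym (+-suc s c)) k<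

∈-upFrom⁺ : ∀ c s {k} → s ≤ k → k < s + c → k ∈ upFrom c s
∈-upFrom⁺ zero    s {k} s≤k k< = contradiction (subst (k <_) (+-identityʳ s) k<) (≤⇒≯ s≤k)
∈-upFrom⁺ (suc c) s {k} s≤k k< with m≤n⇒m<n∨m≡n s≤k
... | inj₂ refl = here refl
... | inj₁ s<k  = there (∈-upFrom⁺ c (suc s) s<k (subst (k <_) (+-suc s c) k<))

-- `between` is defined through a local function of Defs; abstracting its
-- arguments lets unification name that function in upFrom-unique.
between≡upFrom : ∀ {T : Set} i j → between {T = T} i j ≡ upFrom (j ∸ suc i) (suc i)
between≡upFrom i j with upFrom-unique _ (λ _ → refl) (λ _ _ → refl)
... | unique with j ∸ suc i
... | c with suc i
... | s = unique c s

<+∸⇒< : ∀ {s k j} → s ≤ k → k < s + (j ∸ s) → k < j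
<+∸⇒< {s} {k} {j} s≤k k< with s ≤? j
... | yes s≤j = subst (k <_) (m+[n∸m]≡n s≤j) k<
... | no s≰j  = contradiction (subst (k <_) s+[j∸s]≡s k<) (≤⇒≯ s≤k)
  where
  s+[j∸s]≡s : s + (j ∸ s) ≡ s
  s+[j∸s]≡s = trans (cong (s +_) (m≤n⇒m∸n≡0 (<⇒≤ (≰⇒> s≰j)))) (+-identityʳ s)

∈-between⁻ : ∀ {T : Set} {i j k} → k ∈ between {T = T} i j → i < k × k < j
∈-between⁻ {T} {i} {j} {k} k∈
  with ∈-upFrom⁻ (j ∸ suc i) (suc i) (subst (k ∈_) (between≡upFrom {T} i j) k∈)
... | i<k , k< = i<k , <+∸⇒< i<k k<

∈-between⁺ : ∀ {T : Set} {i j k} → i < k → k < j → k ∈ between {T = T} i j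
∈-between⁺ {T} {i} {j} {k} i<k k<j =
  subst (k ∈_) (sym (between≡upFrom {T} i j))
    (∈-upFrom⁺ (j ∸ suc i) (suc i) i<k
      (subst (k <_) (sym (m+[n∸m]≡n (≤-trans i<k (<⇒≤ k<j)))) k<j))

min⁺-≤ : ∀ {T : Set} a as {y} → y ∈ as → min⁺ {T = T} a as ≤ y
min⁺-≤ a as {y} y∈ =
  foldr-preservesᵒ {P = _≤ y} (λ u v → [ m≤n⇒m⊓o≤n v , m≤n⇒o⊓m≤n u ]) a as (inj₂ (lose y∈ ≤-refl))

min⁺-glb : ∀ {T : Set} {b} a as → b ≤ a → (∀ {y} → y ∈ as → b ≤ y) → b ≤ min⁺ {T = T} a as
min⁺-glb {b = b} a as b≤a b≤as = foldr-preservesᵇ {P = b ≤_} ⊓-glb b≤a (tabulate b≤as)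

∨-trueˡ : ∀ {a b} → a ≡ true → a ∨ b ≡ true
∨-trueˡ refl = refl

∨-trueʳ : ∀ a {b} → b ≡ true → a ∨ b ≡ true
∨-trueʳ a refl = ∨-zeroʳ a

≡ᵇ-sound : ∀ {m n} → (m ≡ᵇ n) ≡ true → m ≡ n
≡ᵇ-sound {m} {n} e = ≡ᵇ⇒≡ m n (Equivalence.from T-≡ e)

≟-refl : ∀ n → does (n ≟ n) ≡ true
≟-refl n = dec-true (n ≟ n) refl

h-suc : ∀ {T : Set} (x : List (Sym T)) u → u < length x →
        ∃ λ (c : Sym T) → h x (suc u) ≡ h x u ℤ.+ step c
h-suc (c ∷ s) zero    _ = c , ℤ.+-comm (step c) (ℤ.+ 0)
h-suc (c ∷ s) (suc u) (s≤s u<n) with h-suc s u u<n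
... | c′ , e =
  c′ , trans (cong (λ v → step c ℤ.+ v) e) (sym (ℤ.+-assoc (step c) (h s u) (step c′)))

step-strict : ∀ {T : Set} a (c : Sym T) → a ℤ.< a ℤ.+ step c ⊎ a ℤ.+ step c ℤ.< a
step-strict a (opn _) =
  inj₁ (subst (ℤ._< a ℤ.+ ℤ.1ℤ) (ℤ.+-identityʳ a) (ℤ.+-monoʳ-< a (ℤ.+<+ z<s)))
step-strict a (cls _) =
  inj₂ (subst (a ℤ.+ ℤ.-1ℤ ℤ.<_) (ℤ.+-identityʳ a) (ℤ.+-monoʳ-< a ℤ.-<+))

module _ {T : Set} (x : List (Sym T)) where

  h-never-flat : ∀ {u} → u < length x → h x u ℤ.< h x (suc u) ⊎ h x (suc u) ℤ.< h x u
  h-never-flat {u} u<n with h-suc x u u<n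
  ... | c , e rewrite e = step-strict (h x u) c

  h-suc-≤⇒< : ∀ {u} → u < length x → h x (suc u) ℤ.≤ h x u → h x (suc u) ℤ.< h x u
  h-suc-≤⇒< u<n le = [ (λ rise → contradiction le (ℤ.<⇒≱ rise)) , id ] (h-never-flat u<n)

  h-suc-≥⇒> : ∀ {u} → u < length x → h x u ℤ.≤ h x (suc u) → h x u ℤ.< h x (suc u)
  h-suc-≥⇒> u<n le = [ id , (λ fall → contradiction le (ℤ.<⇒≱ fall)) ] (h-never-flat u<n)

  hmin-from-≤ : ∀ i d {m} → i ≤ m → m ≤ i + d → hmin-from x i d ℤ.≤ h x m
  hmin-from-≤ i zero {m} i≤m m≤i+0 with ≤-antisym i≤m (subst (m ≤_) (+-identityʳ i) m≤i+0)
  ... | refl = ℤ.≤-refl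
  hmin-from-≤ i (suc d) {m} i≤m m≤ with m ≤? i + d
  ... | yes m≤i+d = ℤ.≤-trans (ℤ.i⊓j≤i _ _) (hmin-from-≤ i d i≤m m≤i+d)
  ... | no m≰i+d  = ℤ.≤-trans (ℤ.i⊓j≤j _ _) (ℤ.≤-reflexive (cong (h x) (sym m≡)))
    where
    m≡ : m ≡ i + suc d
    m≡ = ≤-antisym m≤ (subst (_≤ m) (sym (+-suc i d)) (≰⇒> m≰i+d))

  hmin-from-glb : ∀ i d {b} → (∀ {m} → i ≤ m → m ≤ i + d → b ℤ.≤ h x m) →
                  b ℤ.≤ hmin-from x i d
  hmin-from-glb i zero    below = below ≤-refl (m≤m+n i 0)
  hmin-from-glb i (suc d) below =
    ℤ.⊓-glb (hmin-from-glb i d (λ i≤m m≤ → below i≤m (≤-trans m≤ (+-monoʳ-≤ i (n≤1+n d)))))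
            (below (m≤m+n i (suc d)) ≤-refl)

  hr-≤ : ∀ {i j m} → i ≤ m → m ≤ j → hr x i j ℤ.≤ h x m
  hr-≤ {i} {j} {m} i≤m m≤j =
    hmin-from-≤ i (j ∸ i) i≤m (subst (m ≤_) (sym (m+[n∸m]≡n (≤-trans i≤m m≤j))) m≤j)

  hr-glb : ∀ {i j b} → i ≤ j → (∀ {m} → i ≤ m → m ≤ j → b ℤ.≤ h x m) → b ℤ.≤ hr x i j
  hr-glb {i} {j} i≤j below =
    hmin-from-glb i (j ∸ i) (λ i≤m m≤ → below i≤m (subst (_ ≤_) (m+[n∸m]≡n i≤j) m≤))

  Lowest : ℕ → ℕ → ℕ → Set
  Lowest i j k = ∀ {m} → i ≤ m → m ≤ j → h x k ℤ.≤ h x m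

  h≡hr⇒Lowest : ∀ {i j k} → h x k ≡ hr x i j → Lowest i j k
  h≡hr⇒Lowest e i≤m m≤j = subst (ℤ._≤ _) (sym e) (hr-≤ i≤m m≤j)

  Lowest-mono : ∀ {i j a b k} → i ≤ a → b ≤ j → Lowest i j k → Lowest a b k
  Lowest-mono i≤a b≤j low a≤m m≤b = low (≤-trans i≤a a≤m) (≤-trans m≤b b≤j)

  lowest-isValley : ∀ {i j k} → j ≤ length x → i < k → k < j → Lowest i j k →
                    isValley x k ≡ true
  lowest-isValley {k = suc u} j≤n i<k k<j low =
    cong₂ _∧_ (dec-true (suc u <? length x) k<n)
              (cong₂ _∧_ (dec-true (h x (suc u) ℤ.<? h x u) falls)
                         (dec-true (h x (suc u) ℤ.<? h x (suc (suc u))) rises))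
    where
    k<n : suc u < length x
    k<n = <-≤-trans k<j j≤n
    falls : h x (suc u) ℤ.< h x u
    falls = h-suc-≤⇒< (<-trans (n<1+n u) k<n) (low (≤-pred i<k) (≤-trans (n≤1+n u) (<⇒≤ k<j)))
    rises : h x (suc u) ℤ.< h x (suc (suc u))
    rises = h-suc-≥⇒> k<n (low (≤-trans (<⇒≤ i<k) (n≤1+n _)) k<j)

  isValley⇒inK : ∀ {k} → k ≤ length x → isValley x k ≡ true → inK x k ≡ true
  isValley⇒inK {k} k≤n v = cong₂ _∧_ (dec-true (k ≤? length x) k≤n) (∨-trueˡ v)

  data Allowed (i j : ℕ) : ℕ → Set where
    near-valley : ∀ {k} → inK x k ≡ true → Allowed i j k
    i+1 : Allowed i j (suc i)
    i+2 : Allowed i j (suc (suc i))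
    j-2 : Allowed i j (j ∸ 2)
    j-1 : Allowed i j (j ∸ 1)

  allowed⇒Allowed : ∀ {i j k} → allowed x i j k ≡ true → Allowed i j k
  allowed⇒Allowed {i} {j} {k} e
    with inK x k in p | k ≡ᵇ suc i in p₁ | k ≡ᵇ suc (suc i) in p₂
       | k ≡ᵇ j ∸ 2 in p₃ | k ≡ᵇ j ∸ 1 in p₄
  ... | true  | _     | _     | _     | _    = near-valley p
  ... | false | true  | _     | _     | _    = subst (Allowed i j) (sym (≡ᵇ-sound p₁)) i+1
  ... | false | false | true  | _     | _    = subst (Allowed i j) (sym (≡ᵇ-sound p₂)) i+2
  ... | false | false | false | true  | _    = subst (Allowed i j) (sym (≡ᵇ-sound p₃)) j-2
  ... | false | false | false | false | true = subst (Allowed i j) (sym (≡ᵇ-sound p₄)) j-1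
  ... | false | false | false | false | false with () ← e

  Allowed⇒allowed : ∀ {i j k} → Allowed i j k → allowed x i j k ≡ true
  Allowed⇒allowed (near-valley p) = ∨-trueˡ p
  Allowed⇒allowed {k = k} i+1 = ∨-trueʳ (inK x k) (∨-trueˡ (≟-refl k))
  Allowed⇒allowed {i} {k = k} i+2 =
    ∨-trueʳ (inK x k) (∨-trueʳ (does (k ≟ suc i)) (∨-trueˡ (≟-refl k)))
  Allowed⇒allowed {i} {k = k} j-2 =
    ∨-trueʳ (inK x k) (∨-trueʳ (does (k ≟ suc i))
      (∨-trueʳ (does (k ≟ suc (suc i))) (∨-trueˡ (≟-refl k))))
  Allowed⇒allowed {i} {j} {k} j-1 =
    ∨-trueʳ (inK x k) (∨-trueʳ (does (k ≟ suc i)) (∨-trueʳ (does (k ≟ suc (suc i)))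
      (∨-trueʳ (does (k ≟ (j ∸ 2))) (≟-refl k))))

  candidates : ℕ → ℕ → List ℕ
  candidates i j = filter (λ k → allowed x i j k Bool.≟ true) (between {T = T} i j)

  ∈-candidates⁺ : ∀ {i j k} → i < k → k < j → Allowed i j k → k ∈ candidates i j
  ∈-candidates⁺ {i} {j} i<k k<j c =
    ∈-filter⁺ (λ k → allowed x i j k Bool.≟ true) (∈-between⁺ {T} i<k k<j) (Allowed⇒allowed c)

  ∈-candidates⁻ : ∀ {i j k} → k ∈ candidates i j → i < k × k < j × Allowed i j k
  ∈-candidates⁻ {i} {j} k∈ with ∈-filter⁻ (λ k → allowed x i j k Bool.≟ true) k∈
  ... | k∈between , al with ∈-between⁻ {T} k∈between
  ... | i<k , k<j = i<k , k<j , allowed⇒Allowed al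

  Allowed-before : ∀ {i j k k′} → k′ < k → k < j → Allowed i j k′ → Allowed i k k′
  Allowed-before _ _ (near-valley p) = near-valley p
  Allowed-before _ _ i+1 = i+1
  Allowed-before _ _ i+2 = i+2
  Allowed-before {i} {j} {k} k′<k k<j j-2 = subst (Allowed i k) (sym j∸2≡k∸1) j-1
    where
    j∸2≡k∸1 : j ∸ 2 ≡ k ∸ 1
    j∸2≡k∸1 = ≤-antisym (∸-monoˡ-≤ 1 k′<k)
      (subst (k ∸ 1 ≤_) (∸-+-assoc j 1 1) (∸-monoˡ-≤ 1 (∸-monoˡ-≤ 1 k<j)))
  Allowed-before k′<k k<j j-1 = contradiction (∸-monoˡ-≤ 1 k<j) (<⇒≱ k′<k)

  Allowed-after : ∀ {i j k k′} → i < k → k < k′ → Allowed i j k′ → Allowed k j k′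
  Allowed-after _ _ (near-valley p) = near-valley p
  Allowed-after i<k k<k′ i+1 = contradiction k<k′ (≤⇒≯ i<k)
  Allowed-after i<k k<k′ i+2 with ≤-antisym (≤-pred k<k′) i<k
  ... | refl = i+1
  Allowed-after _ _ j-2 = j-2
  Allowed-after _ _ j-1 = j-1

∸-shorter : ∀ {i j a b} → i ≤ a → a ≤ b → b ≤ j → i < a ⊎ b < j → b ∸ a < j ∸ i
∸-shorter {i} {j} {a} {b} i≤a a≤b b≤j (inj₁ i<a) =
  ≤-<-trans (∸-monoˡ-≤ a b≤j) (∸-monoʳ-< i<a (≤-trans a≤b b≤j))
∸-shorter {i} {j} {a} {b} i≤a a≤b b≤j (inj₂ b<j) =
  <-≤-trans (∸-monoˡ-< b<j a≤b) (∸-monoʳ-≤ j i≤a)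

2+≤⇒2≤∸ : ∀ {i j} → 2 + i ≤ j → 2 ≤ j ∸ i
2+≤⇒2≤∸ {i} {j} le = subst (_≤ j ∸ i) (m+n∸n≡m 2 i) (∸-monoˡ-≤ i le)

2+≰⇒∸≤1 : ∀ {i j} → ¬ 2 + i ≤ j → j ∸ i ≤ 1
2+≰⇒∸≤1 {i} {j} nle = subst (j ∸ i ≤_) (m+n∸n≡m 1 i) (∸-monoˡ-≤ i (≤-pred (≰⇒> nle)))

split : (ℕ → ℕ → ℕ) → ℕ → ℕ → ℕ → ℕ
split g i j k = g i k + g k j

module _ {T : Set} (dyck : List (Sym T) → ℕ) (x : List (Sym T)) where

  matchEnds : ℕ → ℕ → ℕ → List ℕ
  matchEnds i j inner =
    if does (hr x i j ℤ.<? hr x (suc i) (j ∸ 1))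
    then (inner + dyck (toL (nth x i) ++ toL (nth x (j ∸ 1)))) ∷ []
    else []

  matchEnds-absent : ∀ {i j} inner → ¬ hr x i j ℤ.< hr x (suc i) (j ∸ 1) →
                     matchEnds i j inner ≡ []
  matchEnds-absent {i} {j} _ no-match
    rewrite dec-false (hr x i j ℤ.<? hr x (suc i) (j ∸ 1)) no-match = refl

  GDstep : (ℕ → ℕ → ℕ) → ℕ → ℕ → ℕ
  GDstep g i j =
    min⁺ {T = T} (split g i j (suc i))
      (map (split g i j) (candidates x i j) ++ matchEnds i j (g (suc i) (j ∸ 1)))

  GDstep-cong : ∀ {g g′} i j → 2 + i ≤ j →
    (∀ {a b} → i ≤ a → a ≤ b → b ≤ j → i < a ⊎ b < j → g a b ≡ g′ a b) →
    GDstep g i j ≡ GDstep g′ i j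
  GDstep-cong {g} {g′} i j i+2≤j g≡g′ =
    cong₂ (min⁺ {T = T}) (split≡ (n<1+n i) i+2≤j)
      (cong₂ _++_ (map-cong-∈ split≡-candidate)
                  (cong (matchEnds i j)
                    (g≡g′ (n≤1+n i) (∸-monoˡ-≤ 1 i+2≤j) (m∸n≤m j 1) (inj₁ (n<1+n i)))))
    where
    split≡ : ∀ {k} → i < k → k < j → split g i j k ≡ split g′ i j k
    split≡ i<k k<j = cong₂ _+_ (g≡g′ ≤-refl (<⇒≤ i<k) (<⇒≤ k<j) (inj₂ k<j))
                               (g≡g′ (<⇒≤ i<k) (<⇒≤ k<j) ≤-refl (inj₁ i<k))
    split≡-candidate : ∀ {k} → k ∈ candidates x i j → split g i j k ≡ split g′ i j k
    split≡-candidate k∈ with ∈-candidates⁻ x k∈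
    ... | i<k , k<j , _ = split≡ i<k k<j
    map-cong-∈ : ∀ {f f′ : ℕ → ℕ} {ks} → (∀ {k} → k ∈ ks → f k ≡ f′ k) → map f ks ≡ map f′ ks
    map-cong-∈ f≡ = map-cong-local (tabulate f≡)

  -- The with-abstraction also reaches the j ∸ i inside the unfolded hr x i j on
  -- the right, but not inside the local definitions of GDf on the left; rewriting
  -- with eq reconciles the two sides.
  GDf-unfold : ∀ F i j → 2 ≤ j ∸ i → GDf dyck (suc F) x i j ≡ GDstep (GDf dyck F x) i j
  GDf-unfold F i j le with j ∸ i in eq
  GDf-unfold F i j (s≤s (s≤s _)) | suc (suc _) rewrite eq = refl

  GDf-short : ∀ F i j → j ∸ i ≤ 1 → GDf dyck (suc F) x i j ≡ j ∸ i
  GDf-short F i j le with j ∸ i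
  ... | zero        = refl
  ... | suc zero    = refl
  ... | suc (suc _) = contradiction le λ { (s≤s ()) }

  GDf-fuel : ∀ F G {i j} → j ∸ i < F → j ∸ i < G → GDf dyck F x i j ≡ GDf dyck G x i j
  GDf-fuel (suc F) (suc G) {i} {j} <F <G with 2 + i ≤? j
  ... | no short = trans (GDf-short F i j (2+≰⇒∸≤1 short)) (sym (GDf-short G i j (2+≰⇒∸≤1 short)))
  ... | yes long = begin
    GDf dyck (suc F) x i j     ≡⟨ GDf-unfold F i j (2+≤⇒2≤∸ long) ⟩
    GDstep (GDf dyck F x) i j  ≡⟨ GDstep-cong i j long shorter-agree ⟩
    GDstep (GDf dyck G x) i j  ≡⟨ GDf-unfold G i j (2+≤⇒2≤∸ long) ⟨
    GDf dyck (suc G) x i j     ∎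
    where
    open ≡-Reasoning
    shorter-agree : ∀ {a b} → i ≤ a → a ≤ b → b ≤ j → i < a ⊎ b < j →
                    GDf dyck F x a b ≡ GDf dyck G x a b
    shorter-agree {a} {b} i≤a a≤b b≤j inner = GDf-fuel F G {a} {b}
      (<-≤-trans (∸-shorter i≤a a≤b b≤j inner) (≤-pred <F))
      (<-≤-trans (∸-shorter i≤a a≤b b≤j inner) (≤-pred <G))

  GD-unfold : ∀ i j → 2 + i ≤ j → GD dyck x i j ≡ GDstep (GD dyck x) i j
  GD-unfold i j long =
    trans (GDf-unfold (j ∸ i) i j (2+≤⇒2≤∸ long))
          (GDstep-cong {GDf dyck (j ∸ i) x} {GD dyck x} i j long λ {a} {b} i≤a a≤b b≤j inner →
            GDf-fuel (j ∸ i) (suc (b ∸ a)) {a} {b} (∸-shorter i≤a a≤b b≤j inner) (n<1+n _))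

  GD-≤-split : ∀ {i j k} → i < k → k < j → Allowed x i j k →
               GD dyck x i j ≤ GD dyck x i k + GD dyck x k j
  GD-≤-split {i} {j} {k} i<k k<j c = begin
    GD dyck x i j           ≡⟨ GD-unfold i j (≤-trans (s≤s i<k) k<j) ⟩
    GDstep (GD dyck x) i j  ≤⟨ min⁺-≤ {T} _ _ (∈-++⁺ˡ (∈-map⁺ (split (GD dyck x) i j) k∈)) ⟩
    split (GD dyck x) i j k ∎
    where
    open ≤-Reasoning
    k∈ : k ∈ candidates x i j
    k∈ = ∈-candidates⁺ x i<k k<j c

  GD-glb : ∀ {i j b} → 2 + i ≤ j → ¬ hr x i j ℤ.< hr x (suc i) (j ∸ 1) →
           (∀ {k} → i < k → k < j → Allowed x i j k → b ≤ GD dyck x i k + GD dyck x k j) →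
           b ≤ GD dyck x i j
  GD-glb {i} {j} {b} long no-match below = begin
    b                       ≤⟨ min⁺-glb {T} _ _ (below (n<1+n i) long i+1) below-options ⟩
    GDstep (GD dyck x) i j  ≡⟨ GD-unfold i j long ⟨
    GD dyck x i j           ∎
    where
    open ≤-Reasoning
    below-options : ∀ {y} → y ∈ map (split (GD dyck x) i j) (candidates x i j)
                                 ++ matchEnds i j (GD dyck x (suc i) (j ∸ 1)) → b ≤ y
    below-options y∈ with ∈-++⁻ (map (split (GD dyck x) i j) (candidates x i j)) y∈
    ... | inj₂ y∈ends = contradiction (subst (_ ∈_) (matchEnds-absent _ no-match) y∈ends) λ ()
    ... | inj₁ y∈splits with ∈-map⁻ (split (GD dyck x) i j) y∈splits
    ... | k , k∈ , refl with ∈-candidates⁻ x k∈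
    ... | i<k , k<j , c = below i<k k<j c

  split≤split-before : ∀ {i j k k′} → i < k′ → k′ < k → k < j → Allowed x i j k′ →
    GD dyck x k′ j ≡ GD dyck x k′ k + GD dyck x k j →
    GD dyck x i k + GD dyck x k j ≤ GD dyck x i k′ + GD dyck x k′ j
  split≤split-before {i} {j} {k} {k′} i<k′ k′<k k<j c right-split = begin
    GD dyck x i k + GD dyck x k j
      ≤⟨ +-monoˡ-≤ _ (GD-≤-split i<k′ k′<k (Allowed-before x k′<k k<j c)) ⟩
    GD dyck x i k′ + GD dyck x k′ k + GD dyck x k j
      ≡⟨ +-assoc (GD dyck x i k′) _ _ ⟩
    GD dyck x i k′ + (GD dyck x k′ k + GD dyck x k j)
      ≡⟨ cong (GD dyck x i k′ +_) right-split ⟨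
    GD dyck x i k′ + GD dyck x k′ j ∎
    where open ≤-Reasoning

  split≤split-after : ∀ {i j k k′} → i < k → k < k′ → k′ < j → Allowed x i j k′ →
    GD dyck x i k′ ≡ GD dyck x i k + GD dyck x k k′ →
    GD dyck x i k + GD dyck x k j ≤ GD dyck x i k′ + GD dyck x k′ j
  split≤split-after {i} {j} {k} {k′} i<k k<k′ k′<j c left-split = begin
    GD dyck x i k + GD dyck x k j
      ≤⟨ +-monoʳ-≤ _ (GD-≤-split k<k′ k′<j (Allowed-after x i<k k<k′ c)) ⟩
    GD dyck x i k + (GD dyck x k k′ + GD dyck x k′ j)
      ≡⟨ +-assoc (GD dyck x i k) _ _ ⟨
    GD dyck x i k + GD dyck x k k′ + GD dyck x k′ j
      ≡⟨ cong (_+ GD dyck x k′ j) left-split ⟨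
    GD dyck x i k′ + GD dyck x k′ j ∎
    where open ≤-Reasoning

  GD-split-at-lowest : ∀ n {i j k} → j ∸ i < n → j ≤ length x → i < k → k < j →
                       Lowest x i j k → GD dyck x i j ≡ GD dyck x i k + GD dyck x k j
  GD-split-at-lowest (suc n) {i} {j} {k} bound j≤n i<k k<j low =
    ≤-antisym (GD-≤-split i<k k<j (near-valley k-inK))
              (GD-glb (≤-trans (s≤s i<k) k<j) no-match optimal)
    where
    k-inK : inK x k ≡ true
    k-inK = isValley⇒inK x (≤-trans (<⇒≤ k<j) j≤n) (lowest-isValley x j≤n i<k k<j low)
    no-match : ¬ hr x i j ℤ.< hr x (suc i) (j ∸ 1)
    no-match = ℤ.≤⇒≯ (ℤ.≤-trans (hr-≤ x i<k (∸-monoˡ-≤ 1 k<j))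
                                 (hr-glb x (≤-trans (<⇒≤ i<k) (<⇒≤ k<j)) low))
    optimal : ∀ {k′} → i < k′ → k′ < j → Allowed x i j k′ →
              GD dyck x i k + GD dyck x k j ≤ GD dyck x i k′ + GD dyck x k′ j
    optimal {k′} i<k′ k′<j c with <-cmp k′ k
    ... | tri≈ _ refl _ = ≤-refl
    ... | tri< k′<k _ _ = split≤split-before i<k′ k′<k k<j c
      (GD-split-at-lowest n (<-≤-trans (∸-monoʳ-< i<k′ (<⇒≤ k′<j)) (≤-pred bound))
        j≤n k′<k k<j (Lowest-mono x {k = k} (<⇒≤ i<k′) ≤-refl low))
    ... | tri> _ _ k<k′ = split≤split-after i<k k<k′ k′<j c
      (GD-split-at-lowest n (<-≤-trans (∸-monoˡ-< k′<j (<⇒≤ i<k′)) (≤-pred bound))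
        (≤-trans (<⇒≤ k′<j) j≤n) i<k k<k′ (Lowest-mono x {k = k} ≤-refl (<⇒≤ k′<j) low))

-- The hypothesis on h(i+1,j−1) follows from the existence of k, which also rules
-- out matching x[i+1] with x[j].
fact4p3 : {T : Set} (dyck : List (Sym T) → ℕ) → IsDyckFun dyck →
    (x : List (Sym T)) (i j : ℕ) → i ≤ length x → j ≤ length x →
    2 + i ≤ j → hr x (1 + i) (j Data.Nat.∸ 1) ≡ hr x i j →
    (k : ℕ) → i < k → k < j → h x k ≡ hr x i j →
    GD dyck x i j ≡ GD dyck x i k + GD dyck x k j
fact4p3 dyck _ x i j _ j≤n _ _ k i<k k<j hk =
  GD-split-at-lowest dyck x (suc (j ∸ i)) ≤-refl j≤n i<k k<j (h≡hr⇒Lowest x {i} {j} {k} hk)
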